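{- Let $n\ge 5$ and suppose that to every $5$-element set $Q\subseteq[n]$ a rotation system $\mathcal{R}(Q)$ on $Q$ is assigned. If $\binom{[n]}{5}$ is not orientable, then there is a $6$-element set $S\subseteq[n]$ such that $\binom{S}{5}$ is not orientable.
   Context: $[n]=\{1,\dots,n\}$. A rotation system on a finite set $Q$ assigns to each $x\in Q$ a cyclic permutation (the rotation of $x$) of $Q\setminus\{x\}$. The inverse $\mathcal{R}^{ -1}$ of a rotation system $\mathcal{R}$ replaces every rotation by its inverse cyclic permutation. Two cyclic permutations of sets $A$ and $B$ are compatible if they are restrictions of a common cyclic permutation of $A\cup B$. For $5$-element sets $Q_1,Q_2$ with $|Q_1\cap Q_2|=4$, rotation systems $\mathcal{R}_1$ on $Q_1$ and $\mathcal{R}_2$ on $Q_2$ are compatible if for every $x\in Q_1\cap Q_2$ the rotations of $x$ in $\mathcal{R}_1$ and $\mathcal{R}_2$ are compatible. A family $\mathcal{W}$ of $5$-element subsets of $[n]$ is orientable if there is a map $\Phi$ assigning to each $Q\in\mathcal{W}$ either $\mathcal{R}(Q)$ or $\mathcal{R}(Q)^{ -1}$ such that for all $Q,Q'\in\mathcal{W}$ with $|Q\cap Q'|=4$, $\Phi(\mathcal{R}(Q))$ and $\Phi(\mathcal{R}(Q'))$ are compatible. -}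

module Defs where

open import Data.Nat using (ℕ)
open import Data.Bool using (Bool; true; false)
open import Data.Fin using (Fin)
open import Data.Fin.Properties using (_≟_)
open import Data.Fin.Subset using (Subset; _∩_; ∣_∣) renaming (_∈_ to _∈ₛ_)
open import Data.List using (List; _++_; reverse; filter)
open import Data.List.Relation.Unary.Unique.Propositional using (Unique)
open import Data.List.Membership.Propositional using (_∈_)
import Data.List.Membership.DecPropositional as DecMem
open import Data.Product using (Σ; ∃; _×_)
open import Data.Sum using (_⊎_)
open import Relation.Binary.PropositionalEquality using (_≡_; _≢_)
open import Function.Bundles using (_⇔_)

-- A cyclic permutation (cyclic order) of a finite set A is represented by a
-- duplicate-free list enumerating A: each element is mapped to its successor
-- in the list, the last element to the first. Two lists represent the same
-- cyclic permutation iff one is a rotation of the other.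
CycEq : ∀ {n} → List (Fin n) → List (Fin n) → Set
CycEq l₁ l₂ = ∃ λ xs → ∃ λ ys → (l₁ ≡ xs ++ ys) × (l₂ ≡ ys ++ xs)

restrictTo : ∀ {n} → List (Fin n) → List (Fin n) → List (Fin n)
restrictTo {n} l L = filter (λ y → DecMem._∈?_ (_≟_ {n}) y l) L

Compatible : ∀ {n} → List (Fin n) → List (Fin n) → Set
Compatible l₁ l₂ =
  ∃ λ L → Unique L
        × (∀ y → (y ∈ L) ⇔ (y ∈ l₁ ⊎ y ∈ l₂))
        × CycEq (restrictTo l₁ L) l₁
        × CycEq (restrictTo l₂ L) l₂

-- ρ is a rotation system on Q: for every x ∈ Q, ρ x is a cyclic permutation
-- of Q ∖ {x}. (Values ρ x for x ∉ Q are irrelevant.)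
IsRotationSystem : ∀ {n} → Subset n → (Fin n → List (Fin n)) → Set
IsRotationSystem Q ρ =
  ∀ x → x ∈ₛ Q → Unique (ρ x) × (∀ y → (y ∈ ρ x) ⇔ (y ∈ₛ Q × y ≢ x))

Assignment : ℕ → Set
Assignment n = Subset n → Fin n → List (Fin n)

-- Choice of R(Q) (false) or its inverse R(Q)⁻¹ (true, every rotation reversed).
orient : ∀ {n} → Bool → List (Fin n) → List (Fin n)
orient false l = l
orient true  l = reverse l

Orientable : ∀ {n} → (Subset n → Set) → Assignment n → Set
Orientable {n} W R =
  Σ (Subset n → Bool) λ Φ →
    ∀ Q Q' → W Q → W Q' → ∣ Q ∩ Q' ∣ ≡ 4 →
    ∀ x → x ∈ₛ Q → x ∈ₛ Q' →
    Compatible (orient (Φ Q) (R Q x)) (orient (Φ Q') (R Q' x))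

module Submission where

-- Let Q = T ∪ {a} and Q′ = T ∪ {b} with |T| = 4, and x ∈ T. The rotations of x in Q and Q′ are
-- cyclic orders of D ∪ {a} and D ∪ {b}, where D = T ∖ {x} has three points, and they are compatible
-- exactly when they induce the same cyclic order on D. Encoding the two cyclic orders of a 3-set by
-- a sign, the orientation choices on Q and Q′ are compatible at x iff they differ by the difference
-- s_x(T,a) ⊕ s_x(T,b) of the signs seen from x. An orientation can therefore fail to exist only for
-- one of two local reasons, each confined to six points: the difference along an edge depends on
-- x (inside T ∪ {a,b}), or, read from a fixed reference point of each 4-set, the differences do not
-- sum to zero around a triangle U ∪ {c,d}, U ∪ {c,z}, U ∪ {d,z} (inside U ∪ {c,d,z}). Otherwise
-- the differences form a cocycle on the Johnson graph of 5-sets that is balanced on all of its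
-- triangles (those with a common 4-set balance automatically), and such a cocycle is a coboundary:
-- adding the points one at a time, a set containing the new point inherits its value along an edge
-- from the sets already treated. That coboundary is an orientation.

open import Defs
open import Data.Bool using (Bool; true; false; not; _xor_)
import Data.Bool as Bool
open import Data.Bool.Properties using (not-¬; not-involutive; xor-assoc; xor-same; xor-identityʳ; xor-comm)
open import Data.Nat using (ℕ; zero; suc; _+_; _≤_)
import Data.Nat as ℕ
open import Data.Nat.Properties using (1+n≢0; <-irrefl; ≤-<-trans; ≤-reflexive; suc-injective)
open import Data.Fin using (Fin; zero; suc; toℕ)
open import Data.Fin.Properties using (toℕ-injective; any?; _≟_)
open import Data.Fin.Subset
  using (Subset; inside; outside; ⁅_⁆; ⊥; _∪_; _∩_; _-_; ∣_∣; _⊆_; Nonempty)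
  renaming (_∈_ to _∈ₛ_; _∉_ to _∉ₛ_)
open import Data.Fin.Subset.Properties
  using (p⊆p∪q; q⊆p∪q; x∈p∪q⁻; x∈⁅x⁆; x∈⁅y⁆⇒x≡y; p─q⊆p; x∈p∧x≢y⇒x∈p-y; ⊆-antisym; p⊆q⇒∣p∣≤∣q∣;
         p⊂q⇒∣p∣<∣q∣; ∪-assoc; ∪-comm; ∪-identityʳ; ∪-distribˡ-∩; Empty-unique; ∣⊥∣≡0; p─⊥≡p;
         x∈p∩q⁺; x∈p∩q⁻; p∩q⊆p; p∩q⊆q; ∩-idem; nonempty?; anySubset?)
  renaming (_∈?_ to _∈ₛ?_)
open import Data.Vec using (_∷_)
open import Data.Vec.Base using () renaming (here to hereₛ; there to thereₛ)
open import Data.List using (List; []; _∷_; _++_; reverse; filter; length; allFin)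
open import Data.List.Properties
  using (∷-injective; ++-identityʳ; ++-assoc; reverse-++;
         filter-++; filter-accept; filter-reject; filter-all; filter-≐)
open import Data.List.Membership.Propositional using (_∈_; _∉_; find; lose)
open import Data.List.Membership.Propositional.Properties using (∈-∃++; ∈-++⁺ˡ; ∈-++⁺ʳ; ∈-allFin)
import Data.List.Membership.DecPropositional as DecMembership
open import Data.List.Relation.Unary.Any as Any using (Any; here; there)
open import Data.List.Relation.Unary.Any.Properties using (¬Any[])
open import Data.List.Relation.Unary.All using (All; []; _∷_) renaming (tabulate to tabulateAll)
open import Data.List.Relation.Unary.All.Properties using (All¬⇒¬Any)
open import Data.List.Relation.Unary.AllPairs using ([]; _∷_)
open import Data.List.Relation.Unary.Unique.Propositional using (Unique)
open import Data.List.Relation.Unary.Unique.Propositional.Properties using (Unique[x∷xs]⇒x∉xs; allFin⁺)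
open import Data.List.Relation.Binary.Permutation.Propositional using (_↭_; ↭-sym; ↭⇒↭ₛ)
open import Data.List.Relation.Binary.Permutation.Propositional.Properties
  using (∈-resp-↭; ↭-reverse; ++-comm)
import Data.List.Relation.Binary.Permutation.Setoid.Properties as Permutationₛ
open import Data.Product using (Σ; ∃; ∃₂; _×_; _,_; proj₁)
open import Data.Sum using (_⊎_; inj₁; inj₂)
import Data.Sum as Sum
open import Data.Empty using (⊥-elim)
open import Function.Bundles using (_⇔_; mk⇔; Equivalence)
open import Relation.Nullary using (Dec; yes; no; ¬_)
open import Relation.Nullary.Decidable using (_×-dec_; ¬?; decidable-stable)
open import Relation.Unary using (Pred; Decidable)
open import Relation.Binary.PropositionalEquality
  using (_≡_; _≢_; ≢-sym; refl; sym; trans; cong; cong₂; subst; subst₂; setoid; module ≡-Reasoning)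

private variable
  n : ℕ
  a b c d a′ b′ c′ p q x y z : Fin n
  xs ys l l′ l₁ l₂ l₃ : List (Fin n)
  X Y D T U Q : Subset n

xor-cancelʳ : ∀ x y → (x xor y) xor y ≡ x
xor-cancelʳ x y = trans (xor-assoc x y y) (trans (cong (x xor_) (xor-same y)) (xor-identityʳ x))

xor-interchange : ∀ a b c d → a xor b ≡ c xor d → a xor c ≡ b xor d
xor-interchange false false false false e = refl
xor-interchange false false true  true  e = refl
xor-interchange false true  false true  e = refl
xor-interchange false true  true  false e = refl
xor-interchange true  false false true  e = refl
xor-interchange true  false true  false e = refl
xor-interchange true  true  false false e = refl
xor-interchange true  true  true  true  e = refl
xor-interchange false false false true  ()
xor-interchange false false true  false ()
xor-interchange false true  false false ()
xor-interchange false true  true  true  ()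
xor-interchange true  false false false ()
xor-interchange true  false true  true  ()
xor-interchange true  true  false true  ()
xor-interchange true  true  true  false ()

xor-triangle : ∀ x y z → (x xor y) xor (x xor z) ≡ y xor z
xor-triangle false y     z = refl
xor-triangle true  false z = not-involutive z
xor-triangle true  true  z = refl

xor-not³ : ∀ x y z → not y xor not x xor not z ≡ not (x xor y xor z)
xor-not³ false false false = refl
xor-not³ false false true  = refl
xor-not³ false true  false = refl
xor-not³ false true  true  = refl
xor-not³ true  false false = refl
xor-not³ true  false true  = refl
xor-not³ true  true  false = refl
xor-not³ true  true  true  = refl

-- Cyclic orders as lists up to rotation

CycEq-refl : ∀ (l : List (Fin n)) → CycEq l l
CycEq-refl l = [] , l , refl , sym (++-identityʳ l)

CycEq-sym : CycEq l₁ l₂ → CycEq l₂ l₁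
CycEq-sym (xs , ys , refl , refl) = ys , xs , refl , refl

++-split : ∀ {A : Set} (as bs cs ds : List A) → as ++ bs ≡ cs ++ ds →
           (∃ λ m → cs ≡ as ++ m × bs ≡ m ++ ds) ⊎ (∃ λ m → as ≡ cs ++ m × ds ≡ m ++ bs)
++-split []       bs cs       ds e = inj₁ (cs , refl , e)
++-split (a ∷ as) bs []       ds e = inj₂ (a ∷ as , refl , sym e)
++-split (a ∷ as) bs (c ∷ cs) ds e with ∷-injective e
... | refl , e′ with ++-split as bs cs ds e′
...   | inj₁ (m , refl , refl) = inj₁ (m , refl , refl)
...   | inj₂ (m , refl , refl) = inj₂ (m , refl , refl)

CycEq-trans : CycEq l₁ l₂ → CycEq l₂ l₃ → CycEq l₁ l₃
CycEq-trans (xs , ys , refl , refl) (us , vs , e , refl) with ++-split ys xs us vs e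
... | inj₁ (m , refl , refl) = m , vs ++ ys , ++-assoc m vs ys , sym (++-assoc vs ys m)
... | inj₂ (m , refl , refl) = xs ++ us , m , sym (++-assoc xs us m) , ++-assoc m xs us

CycEq⇒↭ : CycEq l₁ l₂ → l₁ ↭ l₂
CycEq⇒↭ (xs , ys , refl , refl) = ++-comm xs ys

CycEq-filter : ∀ {ℓ} {P : Pred (Fin n) ℓ} (P? : Decidable P) →
               CycEq l₁ l₂ → CycEq (filter P? l₁) (filter P? l₂)
CycEq-filter P? (xs , ys , refl , refl) =
  filter P? xs , filter P? ys , filter-++ P? xs ys , filter-++ P? ys xs

CycEq-reverse : CycEq l₁ l₂ → CycEq (reverse l₁) (reverse l₂)
CycEq-reverse (xs , ys , refl , refl) = reverse ys , reverse xs , reverse-++ xs ys , reverse-++ ys xs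

CycEq-toFront : ∀ (xs : List (Fin n)) p ys → CycEq (xs ++ p ∷ ys) (p ∷ ys ++ xs)
CycEq-toFront xs p ys = xs , p ∷ ys , refl , refl

Unique-resp-↭ : l ↭ l′ → Unique l → Unique l′
Unique-resp-↭ σ = Permutationₛ.Unique-resp-↭ (setoid _) (↭⇒↭ₛ σ)

member? : (l : List (Fin n)) → Decidable (_∈ l)
member? l y = DecMembership._∈?_ _≟_ y l

filter-absorb : ∀ {a ℓ₁ ℓ₂} {A : Set a} {P : Pred A ℓ₁} {Q : Pred A ℓ₂}
                (P? : Decidable P) (Q? : Decidable Q) →
                (∀ {y} → P y → Q y) → ∀ L → filter P? (filter Q? L) ≡ filter P? L
filter-absorb P? Q? P⊆Q [] = refl
filter-absorb P? Q? P⊆Q (y ∷ L) with Q? y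
... | yes _ with P? y
...   | yes _ = cong (y ∷_) (filter-absorb P? Q? P⊆Q L)
...   | no _  = filter-absorb P? Q? P⊆Q L
filter-absorb P? Q? P⊆Q (y ∷ L) | no ¬Qy with P? y
...   | yes Py = ⊥-elim (¬Qy (P⊆Q Py))
...   | no _   = filter-absorb P? Q? P⊆Q L

-- The sign is the parity of the number of cyclic ascents: three distinct points have one ascent
-- in one orientation and two in the other.
ascent : Fin n → Fin n → Bool
ascent u v = toℕ u ℕ.<ᵇ toℕ v

sign : List (Fin n) → Bool
sign (u ∷ v ∷ w ∷ []) = ascent u v xor ascent v w xor ascent w u
sign _                = false

<ᵇ-flip : ∀ {m k} → m ≢ k → (k ℕ.<ᵇ m) ≡ not (m ℕ.<ᵇ k)
<ᵇ-flip {zero}  {zero}  m≢k = ⊥-elim (m≢k refl)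
<ᵇ-flip {zero}  {suc k} m≢k = refl
<ᵇ-flip {suc m} {zero}  m≢k = refl
<ᵇ-flip {suc m} {suc k} m≢k = <ᵇ-flip (λ m≡k → m≢k (cong suc m≡k))

ascent-flip : a ≢ b → ascent b a ≡ not (ascent a b)
ascent-flip a≢b = <ᵇ-flip (λ e → a≢b (toℕ-injective e))

sign-rotate : ∀ (a b c : Fin n) → sign (b ∷ c ∷ a ∷ []) ≡ sign (a ∷ b ∷ c ∷ [])
sign-rotate a b c = sym (trans (xor-comm (ascent a b) _) (xor-assoc (ascent b c) (ascent c a) (ascent a b)))

sign-reverse : a ≢ b → b ≢ c → c ≢ a → sign (c ∷ b ∷ a ∷ []) ≡ not (sign (a ∷ b ∷ c ∷ []))
sign-reverse {a = a} {b} {c} a≢b b≢c c≢a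
  rewrite ascent-flip b≢c | ascent-flip a≢b | ascent-flip c≢a =
  xor-not³ (ascent a b) (ascent b c) (ascent c a)

sign-cycEq : CycEq l (a ∷ b ∷ c ∷ []) → sign l ≡ sign (a ∷ b ∷ c ∷ [])
sign-cycEq (xs , []                , refl , refl) = refl
sign-cycEq {a = a} {b} {c} (xs , _ ∷ []     , refl , refl) = sign-rotate a b c
sign-cycEq {a = a} {b} {c} (xs , _ ∷ _ ∷ [] , refl , refl) = trans (sign-rotate b c a) (sign-rotate a b c)
sign-cycEq (xs , _ ∷ _ ∷ _ ∷ []     , refl , refl) = refl
sign-cycEq (xs , _ ∷ _ ∷ _ ∷ _ ∷ _  , refl , ())

∈₃ : ∀ {y} → y ∈ a ∷ b ∷ c ∷ [] → y ≡ a ⊎ y ≡ b ⊎ y ≡ c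
∈₃ (here e)                 = inj₁ e
∈₃ (there (here e))         = inj₂ (inj₁ e)
∈₃ (there (there (here e))) = inj₂ (inj₂ e)

sign≡⇒CycEq : Unique (a ∷ b ∷ c ∷ []) → Unique (a′ ∷ b′ ∷ c′ ∷ []) →
              (∀ {y} → y ∈ a′ ∷ b′ ∷ c′ ∷ [] → y ∈ a ∷ b ∷ c ∷ []) →
              sign (a′ ∷ b′ ∷ c′ ∷ []) ≡ sign (a ∷ b ∷ c ∷ []) →
              CycEq (a′ ∷ b′ ∷ c′ ∷ []) (a ∷ b ∷ c ∷ [])
sign≡⇒CycEq {a = a} {b} {c} ((a≢b ∷ a≢c ∷ []) ∷ (b≢c ∷ []) ∷ [] ∷ [])
            ((a′≢b′ ∷ a′≢c′ ∷ []) ∷ (b′≢c′ ∷ []) ∷ [] ∷ []) ⊆A same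
  with ∈₃ (⊆A (here refl)) | ∈₃ (⊆A (there (here refl))) | ∈₃ (⊆A (there (there (here refl))))
... | inj₁ refl        | inj₁ refl        | _                = ⊥-elim (a′≢b′ refl)
... | inj₁ refl        | _                | inj₁ refl        = ⊥-elim (a′≢c′ refl)
... | _                | inj₁ refl        | inj₁ refl        = ⊥-elim (b′≢c′ refl)
... | inj₂ (inj₁ refl) | inj₂ (inj₁ refl) | _                = ⊥-elim (a′≢b′ refl)
... | inj₂ (inj₁ refl) | _                | inj₂ (inj₁ refl) = ⊥-elim (a′≢c′ refl)
... | _                | inj₂ (inj₁ refl) | inj₂ (inj₁ refl) = ⊥-elim (b′≢c′ refl)
... | inj₂ (inj₂ refl) | inj₂ (inj₂ refl) | _                = ⊥-elim (a′≢b′ refl)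
... | inj₂ (inj₂ refl) | _                | inj₂ (inj₂ refl) = ⊥-elim (a′≢c′ refl)
... | _                | inj₂ (inj₂ refl) | inj₂ (inj₂ refl) = ⊥-elim (b′≢c′ refl)
... | inj₁ refl        | inj₂ (inj₁ refl) | inj₂ (inj₂ refl) = CycEq-refl _
... | inj₂ (inj₁ refl) | inj₂ (inj₂ refl) | inj₁ refl        = b ∷ c ∷ [] , a ∷ [] , refl , refl
... | inj₂ (inj₂ refl) | inj₁ refl        | inj₂ (inj₁ refl) = c ∷ [] , a ∷ b ∷ [] , refl , refl
-- the three odd arrangements are reversals of rotations of a, b, c
... | inj₁ refl        | inj₂ (inj₂ refl) | inj₂ (inj₁ refl) =
  ⊥-elim (not-¬ same (trans (sign-reverse b≢c (≢-sym a≢c) a≢b) (cong not (sign-rotate a b c))))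
... | inj₂ (inj₁ refl) | inj₁ refl        | inj₂ (inj₂ refl) =
  ⊥-elim (not-¬ same (trans (sign-reverse (≢-sym a≢c) a≢b b≢c)
                            (cong not (trans (sign-rotate b c a) (sign-rotate a b c)))))
... | inj₂ (inj₂ refl) | inj₂ (inj₁ refl) | inj₁ refl        =
  ⊥-elim (not-¬ same (sign-reverse a≢b b≢c (≢-sym a≢c)))

∈-insert⁺ : x ∈ₛ X → x ∈ₛ X ∪ ⁅ a ⁆
∈-insert⁺ {a = a} = p⊆p∪q ⁅ a ⁆

∈-insert-self : a ∈ₛ X ∪ ⁅ a ⁆
∈-insert-self {a = a} {X = X} = q⊆p∪q X ⁅ a ⁆ (x∈⁅x⁆ a)

∈-insert⁻ : x ∈ₛ X ∪ ⁅ a ⁆ → x ∈ₛ X ⊎ x ≡ a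
∈-insert⁻ {X = X} {a = a} x∈ with x∈p∪q⁻ X ⁅ a ⁆ x∈
... | inj₁ x∈X = inj₁ x∈X
... | inj₂ x∈a = inj₂ (x∈⁅y⁆⇒x≡y a x∈a)

∉-insert : x ∉ₛ X → x ≢ a → x ∉ₛ X ∪ ⁅ a ⁆
∉-insert x∉X x≢a x∈ with ∈-insert⁻ x∈
... | inj₁ x∈X = x∉X x∈X
... | inj₂ x≡a = x≢a x≡a

insert-⊆ : X ⊆ Y → a ∈ₛ Y → X ∪ ⁅ a ⁆ ⊆ Y
insert-⊆ X⊆Y a∈Y x∈ with ∈-insert⁻ x∈
... | inj₁ x∈X  = X⊆Y x∈X
... | inj₂ refl = a∈Y

∉-remove-self : x ∉ₛ X - x
∉-remove-self {x = zero}  {X = s ∷ X} ()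
∉-remove-self {x = suc x} {X = s ∷ X} (thereₛ x∈) = ∉-remove-self x∈

∈-remove⁻ : x ∈ₛ X - y → x ∈ₛ X × x ≢ y
∈-remove⁻ {X = X} {y = y} x∈ = p─q⊆p X ⁅ y ⁆ x∈ , λ { refl → ∉-remove-self x∈ }

∣insert∣ : a ∉ₛ X → ∣ X ∪ ⁅ a ⁆ ∣ ≡ suc ∣ X ∣
∣insert∣ {a = zero}  {X = inside  ∷ X} a∉ = ⊥-elim (a∉ hereₛ)
∣insert∣ {a = zero}  {X = outside ∷ X} a∉ = cong suc (cong ∣_∣ (∪-identityʳ X))
∣insert∣ {a = suc a} {X = inside  ∷ X} a∉ = cong suc (∣insert∣ (λ a∈ → a∉ (thereₛ a∈)))
∣insert∣ {a = suc a} {X = outside ∷ X} a∉ = ∣insert∣ (λ a∈ → a∉ (thereₛ a∈))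

∣remove∣ : x ∈ₛ X → ∣ X ∣ ≡ suc ∣ X - x ∣
∣remove∣ {x = zero}  {X = inside ∷ X} hereₛ = cong suc (sym (cong ∣_∣ (p─⊥≡p X)))
∣remove∣ {x = suc x} {X = inside  ∷ X} (thereₛ x∈) = cong suc (∣remove∣ x∈)
∣remove∣ {x = suc x} {X = outside ∷ X} (thereₛ x∈) = ∣remove∣ x∈

∣insert²∣ : ∀ {k} → ∣ X ∣ ≡ k → a ∉ₛ X → b ∉ₛ X → a ≢ b → ∣ (X ∪ ⁅ a ⁆) ∪ ⁅ b ⁆ ∣ ≡ suc (suc k)
∣insert²∣ ∣X∣ a∉X b∉X a≢b =
  trans (∣insert∣ (∉-insert b∉X (≢-sym a≢b))) (cong suc (trans (∣insert∣ a∉X) (cong suc ∣X∣)))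

insert-comm : ∀ (X : Subset n) a b → (X ∪ ⁅ a ⁆) ∪ ⁅ b ⁆ ≡ (X ∪ ⁅ b ⁆) ∪ ⁅ a ⁆
insert-comm X a b =
  trans (∪-assoc X ⁅ a ⁆ ⁅ b ⁆) (trans (cong (X ∪_) (∪-comm ⁅ a ⁆ ⁅ b ⁆)) (sym (∪-assoc X ⁅ b ⁆ ⁅ a ⁆)))

insert-∩ : ∀ (X : Subset n) → a ≢ b → (X ∪ ⁅ a ⁆) ∩ (X ∪ ⁅ b ⁆) ≡ X
insert-∩ {a = a} {b = b} X a≢b = begin
  (X ∪ ⁅ a ⁆) ∩ (X ∪ ⁅ b ⁆) ≡⟨ ∪-distribˡ-∩ X ⁅ a ⁆ ⁅ b ⁆ ⟨
  X ∪ (⁅ a ⁆ ∩ ⁅ b ⁆)       ≡⟨ cong (X ∪_) (Empty-unique disjoint) ⟩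
  X ∪ ⊥                     ≡⟨ ∪-identityʳ X ⟩
  X                         ∎
  where
  open ≡-Reasoning
  disjoint : ¬ ∃ (_∈ₛ ⁅ a ⁆ ∩ ⁅ b ⁆)
  disjoint (x , x∈) with x∈p∩q⁻ ⁅ a ⁆ ⁅ b ⁆ x∈
  ... | x∈a , x∈b = a≢b (trans (sym (x∈⁅y⁆⇒x≡y a x∈a)) (x∈⁅y⁆⇒x≡y b x∈b))

remove-insert : a ∉ₛ X → (X ∪ ⁅ a ⁆) - a ≡ X
remove-insert {a = a} {X = X} a∉X = ⊆-antisym to from
  where
  to : ∀ {x} → x ∈ₛ (X ∪ ⁅ a ⁆) - a → x ∈ₛ X
  to x∈ with ∈-remove⁻ x∈
  ... | x∈′ , x≢a with ∈-insert⁻ x∈′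
  ...   | inj₁ x∈X  = x∈X
  ...   | inj₂ x≡a  = ⊥-elim (x≢a x≡a)
  from : ∀ {x} → x ∈ₛ X → x ∈ₛ (X ∪ ⁅ a ⁆) - a
  from x∈X = x∈p∧x≢y⇒x∈p-y (∈-insert⁺ x∈X) (λ { refl → a∉X x∈X })

insert-remove : x ∈ₛ X → (X - x) ∪ ⁅ x ⁆ ≡ X
insert-remove {x = x} {X = X} x∈X = ⊆-antisym to from
  where
  to : ∀ {y} → y ∈ₛ (X - x) ∪ ⁅ x ⁆ → y ∈ₛ X
  to y∈ with ∈-insert⁻ y∈
  ... | inj₁ y∈X-x = proj₁ (∈-remove⁻ y∈X-x)
  ... | inj₂ refl  = x∈X
  from : ∀ {y} → y ∈ₛ X → y ∈ₛ (X - x) ∪ ⁅ x ⁆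
  from {y} y∈X with y ≟ x
  ... | yes refl = ∈-insert-self
  ... | no y≢x   = ∈-insert⁺ (x∈p∧x≢y⇒x∈p-y y∈X y≢x)

⊆-or-∉ : ∀ (X Y : Subset n) → X ⊆ Y ⊎ ∃ λ x → x ∈ₛ X × x ∉ₛ Y
⊆-or-∉ X Y with any? (λ x → x ∈ₛ? X ×-dec ¬? (x ∈ₛ? Y))
... | yes (x , x∈X , x∉Y) = inj₂ (x , x∈X , x∉Y)
... | no ∄                = inj₁ λ {x} x∈X → decidable-stable (x ∈ₛ? Y) (λ x∉Y → ∄ (x , x∈X , x∉Y))

⊆∧∣∣≤⇒≡ : X ⊆ Y → ∣ Y ∣ ≤ ∣ X ∣ → X ≡ Y
⊆∧∣∣≤⇒≡ {X = X} {Y = Y} X⊆Y ∣Y∣≤∣X∣ with ⊆-or-∉ Y X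
... | inj₁ Y⊆X              = ⊆-antisym X⊆Y Y⊆X
... | inj₂ (x , x∈Y , x∉X) =
  ⊥-elim (<-irrefl refl (≤-<-trans ∣Y∣≤∣X∣ (p⊂q⇒∣p∣<∣q∣ (X⊆Y , x , x∈Y , x∉X))))

insert-decomposition : T ⊆ Q → ∣ Q ∣ ≡ suc ∣ T ∣ → ∃ λ a → a ∉ₛ T × Q ≡ T ∪ ⁅ a ⁆
insert-decomposition {T = T} {Q = Q} T⊆Q ∣Q∣≡ with ⊆-or-∉ Q T
... | inj₁ Q⊆T = ⊥-elim (<-irrefl refl (subst (_≤ ∣ T ∣) ∣Q∣≡ (p⊆q⇒∣p∣≤∣q∣ Q⊆T)))
... | inj₂ (a , a∈Q , a∉T) =
  a , a∉T , sym (⊆∧∣∣≤⇒≡ (insert-⊆ T⊆Q a∈Q) (≤-reflexive (trans ∣Q∣≡ (sym (∣insert∣ a∉T)))))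

enumeration-length : ∀ {l : List (Fin n)} {D} → Unique l →
                     (∀ {y} → y ∈ l → y ∈ₛ D) → (∀ {y} → y ∈ₛ D → y ∈ l) → length l ≡ ∣ D ∣
enumeration-length {n = n} {l = []} _ _ complete =
  sym (trans (cong ∣_∣ (Empty-unique (λ { (y , y∈D) → ¬Any[] (complete y∈D) }))) (∣⊥∣≡0 n))
enumeration-length {l = x ∷ l} {D} u@(_ ∷ ul) sound complete =
  trans (cong suc (enumeration-length {D = D - x} ul sound′ complete′)) (sym (∣remove∣ (sound (here refl))))
  where
  sound′ : ∀ {y} → y ∈ l → y ∈ₛ D - x
  sound′ y∈l = x∈p∧x≢y⇒x∈p-y (sound (there y∈l)) (λ { refl → Unique[x∷xs]⇒x∉xs u y∈l })
  complete′ : ∀ {y} → y ∈ₛ D - x → y ∈ l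
  complete′ y∈ with ∈-remove⁻ y∈
  ... | y∈D , y≢x with complete y∈D
  ...   | here y≡x   = ⊥-elim (y≢x y≡x)
  ...   | there y∈l = y∈l

∣∣≡suc⇒Nonempty : ∀ {n k} {X : Subset n} → ∣ X ∣ ≡ suc k → Nonempty X
∣∣≡suc⇒Nonempty {n = n} {X = X} ∣X∣ with nonempty? X
... | yes ne = ne
... | no ¬ne = ⊥-elim (1+n≢0 (trans (sym ∣X∣) (trans (cong ∣_∣ (Empty-unique ¬ne)) (∣⊥∣≡0 n))))

-- Compatibility of cyclic orders of D ∪ {p} and D ∪ {q}

record IsCyclicOrderOn (D : Subset n) (p : Fin n) (l : List (Fin n)) : Set where
  field
    unique   : Unique l
    sound    : ∀ {y} → y ∈ l → y ∈ₛ D ⊎ y ≡ p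
    complete : ∀ {y} → y ∈ₛ D ⊎ y ≡ p → y ∈ l
    fresh    : p ∉ₛ D

open IsCyclicOrderOn

IsCyclicOrderOn-resp-↭ : l ↭ l′ → IsCyclicOrderOn D p l → IsCyclicOrderOn D p l′
IsCyclicOrderOn-resp-↭ σ o = record
  { unique   = Unique-resp-↭ σ (unique o)
  ; sound    = λ y∈ → sound o (∈-resp-↭ (↭-sym σ) y∈)
  ; complete = λ y∈ → ∈-resp-↭ σ (complete o y∈)
  ; fresh    = fresh o
  }

IsCyclicOrderOn-orient : ∀ β → IsCyclicOrderOn D p l → IsCyclicOrderOn D p (orient β l)
IsCyclicOrderOn-orient false o = o
IsCyclicOrderOn-orient {l = l} true o = IsCyclicOrderOn-resp-↭ (↭-sym (↭-reverse l)) o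

tail⊆ : ∀ {A} → IsCyclicOrderOn D p (p ∷ A) → ∀ {y} → y ∈ A → y ∈ₛ D
tail⊆ o y∈A with sound o (there y∈A)
... | inj₁ y∈D  = y∈D
... | inj₂ refl = ⊥-elim (Unique[x∷xs]⇒x∉xs (unique o) y∈A)

⊆tail : ∀ {A} → IsCyclicOrderOn D p (p ∷ A) → ∀ {y} → y ∈ₛ D → y ∈ A
⊆tail o y∈D with complete o (inj₁ y∈D)
... | here refl = ⊥-elim (fresh o y∈D)
... | there y∈A = y∈A

normalForm : IsCyclicOrderOn D p l → ∣ D ∣ ≡ 3 → ∃₂ λ a b → ∃ λ c → CycEq l (p ∷ a ∷ b ∷ c ∷ [])
normalForm {D = D} {p = p} o ∣D∣≡3 with ∈-∃++ (complete o (inj₂ refl))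
... | xs , ys , refl with IsCyclicOrderOn-resp-↭ (CycEq⇒↭ (CycEq-toFront xs p ys)) o
...   | o′@record { unique = _ ∷ uA } =
  triple (ys ++ xs) (CycEq-toFront xs p ys) (trans (enumeration-length uA (tail⊆ o′) (⊆tail o′)) ∣D∣≡3)
  where
  triple : ∀ A → CycEq (xs ++ p ∷ ys) (p ∷ A) → length A ≡ 3 →
           ∃₂ λ a b → ∃ λ c → CycEq (xs ++ p ∷ ys) (p ∷ a ∷ b ∷ c ∷ [])
  triple (a ∷ b ∷ c ∷ []) r _ = a , b , c , r

signOn : Subset n → List (Fin n) → Bool
signOn D l = sign (filter (_∈ₛ? D) l)

restriction-normal : ∀ {a b c} → IsCyclicOrderOn D p l → CycEq l (p ∷ a ∷ b ∷ c ∷ []) →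
                     CycEq (filter (_∈ₛ? D) l) (a ∷ b ∷ c ∷ [])
restriction-normal {D = D} o r = subst (CycEq _) tail-filtered (CycEq-filter (_∈ₛ? D) r)
  where
  o′ = IsCyclicOrderOn-resp-↭ (CycEq⇒↭ r) o
  tail-filtered = trans (filter-reject (_∈ₛ? D) (fresh o′)) (filter-all (_∈ₛ? D) (tabulateAll (tail⊆ o′)))

signOn-normal : ∀ {a b c} → IsCyclicOrderOn D p l → CycEq l (p ∷ a ∷ b ∷ c ∷ []) →
                signOn D l ≡ sign (a ∷ b ∷ c ∷ [])
signOn-normal o r = sign-cycEq (restriction-normal o r)

restriction-sign : ∀ {L} → IsCyclicOrderOn D p l → ∣ D ∣ ≡ 3 → CycEq (restrictTo l L) l →
                   sign (filter (_∈ₛ? D) L) ≡ signOn D l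
restriction-sign {D = D} {l = l} {L} o ∣D∣≡3 restricted with normalForm o ∣D∣≡3
... | _ , _ , _ , r = trans (sign-cycEq (CycEq-trans viaL (restriction-normal o r))) (sym (signOn-normal o r))
  where
  viaL : CycEq (filter (_∈ₛ? D) L) (filter (_∈ₛ? D) l)
  viaL = subst (λ M → CycEq M _) (filter-absorb (_∈ₛ? D) (member? l) (λ y∈D → complete o (inj₁ y∈D)) L)
               (CycEq-filter (_∈ₛ? D) restricted)

compatible⇒signOn≡ : ∀ {l₁ l₂} → IsCyclicOrderOn D p l₁ → IsCyclicOrderOn D q l₂ → ∣ D ∣ ≡ 3 →
                     Compatible l₁ l₂ → signOn D l₁ ≡ signOn D l₂
compatible⇒signOn≡ o₁ o₂ ∣D∣≡3 (L , _ , _ , c₁ , c₂) =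
  trans (sym (restriction-sign {L = L} o₁ ∣D∣≡3 c₁)) (restriction-sign {L = L} o₂ ∣D∣≡3 c₂)

restrictTo-resp-↭ : ∀ {l l′ : List (Fin n)} → l ↭ l′ → ∀ L → restrictTo l L ≡ restrictTo l′ L
restrictTo-resp-↭ σ = filter-≐ _ _ ((λ y∈ → ∈-resp-↭ σ y∈) , (λ y∈ → ∈-resp-↭ (↭-sym σ) y∈))

Compatible-resp-CycEq : ∀ {l₁ l₁′ l₂ l₂′ : List (Fin n)} → CycEq l₁ l₁′ → CycEq l₂ l₂′ →
                        Compatible l₁′ l₂′ → Compatible l₁ l₂
Compatible-resp-CycEq {l₁ = l₁} {l₁′} {l₂} {l₂′} r₁ r₂ (L , uL , members , c₁ , c₂) =
  L , uL , members′ , restricted r₁ c₁ , restricted r₂ c₂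
  where
  σ₁ = CycEq⇒↭ r₁
  σ₂ = CycEq⇒↭ r₂
  members′ : ∀ y → (y ∈ L) ⇔ (y ∈ l₁ ⊎ y ∈ l₂)
  members′ y = mk⇔
    (λ y∈L → Sum.map (∈-resp-↭ (↭-sym σ₁)) (∈-resp-↭ (↭-sym σ₂)) (Equivalence.to (members y) y∈L))
    (λ y∈ → Equivalence.from (members y) (Sum.map (∈-resp-↭ σ₁) (∈-resp-↭ σ₂) y∈))
  restricted : ∀ {l l′} → CycEq l l′ → CycEq (restrictTo l′ L) l′ → CycEq (restrictTo l L) l
  restricted r c =
    subst (λ M → CycEq M _) (sym (restrictTo-resp-↭ (CycEq⇒↭ r) L)) (CycEq-trans c (CycEq-sym r))

-- The common refinement inserts q into the cyclic order p, ys, xs between ys and xs.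
compatible-normal : ∀ {xs ys} → IsCyclicOrderOn D p (p ∷ ys ++ xs) → IsCyclicOrderOn D q (q ∷ xs ++ ys) →
                    p ≢ q → Compatible (p ∷ ys ++ xs) (q ∷ xs ++ ys)
compatible-normal {D = D} {p = p} {q = q} {xs} {ys} o₁ o₂ p≢q =
  p ∷ rest , unique-L , members ,
  subst (λ M → CycEq M _) (sym restrict₁) (CycEq-refl _) ,
  subst (λ M → CycEq M _) (sym restrict₂) (ys , q ∷ xs , refl , refl)
  where
  rest = ys ++ q ∷ xs
  σ : q ∷ xs ++ ys ↭ rest
  σ = CycEq⇒↭ (q ∷ xs , ys , refl , refl)
  rest⊆l₂ : ∀ {y} → y ∈ rest → y ∈ q ∷ xs ++ ys
  rest⊆l₂ = ∈-resp-↭ (↭-sym σ)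
  p∉l₂ : p ∉ q ∷ xs ++ ys
  p∉l₂ p∈ with sound o₂ p∈
  ... | inj₁ p∈D = fresh o₁ p∈D
  ... | inj₂ p≡q = p≢q p≡q
  q∉l₁ : q ∉ p ∷ ys ++ xs
  q∉l₁ q∈ with sound o₁ q∈
  ... | inj₁ q∈D = fresh o₂ q∈D
  ... | inj₂ q≡p = p≢q (sym q≡p)
  unique-L : Unique (p ∷ rest)
  unique-L = tabulateAll (λ y∈ p≡y → p∉l₂ (subst (_∈ _) (sym p≡y) (rest⊆l₂ y∈)))
           ∷ Unique-resp-↭ σ (unique o₂)
  members : ∀ y → (y ∈ p ∷ rest) ⇔ (y ∈ p ∷ ys ++ xs ⊎ y ∈ q ∷ xs ++ ys)
  members y = mk⇔ to from
    where
    to : y ∈ p ∷ rest → y ∈ p ∷ ys ++ xs ⊎ y ∈ q ∷ xs ++ ys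
    to (here y≡p)  = inj₁ (here y≡p)
    to (there y∈) = inj₂ (rest⊆l₂ y∈)
    from : y ∈ p ∷ ys ++ xs ⊎ y ∈ q ∷ xs ++ ys → y ∈ p ∷ rest
    from (inj₁ y∈l₁) with sound o₁ y∈l₁
    ... | inj₁ y∈D = there (∈-resp-↭ σ (complete o₂ (inj₁ y∈D)))
    ... | inj₂ y≡p = here y≡p
    from (inj₂ y∈l₂) = there (∈-resp-↭ σ y∈l₂)
  in₁ = member? (p ∷ ys ++ xs)
  in₂ = member? (q ∷ xs ++ ys)
  restrict₁ : restrictTo (p ∷ ys ++ xs) (p ∷ rest) ≡ p ∷ ys ++ xs
  restrict₁ = trans (filter-accept in₁ (here refl)) (cong (p ∷_) (begin
    filter in₁ (ys ++ q ∷ xs)            ≡⟨ filter-++ in₁ ys (q ∷ xs) ⟩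
    filter in₁ ys ++ filter in₁ (q ∷ xs) ≡⟨ cong (_++ filter in₁ (q ∷ xs)) (filter-all in₁ ys∈) ⟩
    ys ++ filter in₁ (q ∷ xs)            ≡⟨ cong (ys ++_) (filter-reject in₁ q∉l₁) ⟩
    ys ++ filter in₁ xs                  ≡⟨ cong (ys ++_) (filter-all in₁ xs∈) ⟩
    ys ++ xs                             ∎))
    where
    open ≡-Reasoning
    ys∈ = tabulateAll (λ y∈ → there (∈-++⁺ˡ y∈))
    xs∈ = tabulateAll (λ y∈ → there (∈-++⁺ʳ ys y∈))
  restrict₂ : restrictTo (q ∷ xs ++ ys) (p ∷ rest) ≡ rest
  restrict₂ = trans (filter-reject in₂ p∉l₂) (filter-all in₂ (tabulateAll rest⊆l₂))

signOn≡⇒compatible : ∀ {l₁ l₂} → IsCyclicOrderOn D p l₁ → IsCyclicOrderOn D q l₂ → ∣ D ∣ ≡ 3 → p ≢ q →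
                     signOn D l₁ ≡ signOn D l₂ → Compatible l₁ l₂
signOn≡⇒compatible {D = D} {p = p} {q = q} o₁ o₂ ∣D∣≡3 p≢q same
  with normalForm o₁ ∣D∣≡3 | normalForm o₂ ∣D∣≡3
... | a , b , c , r₁ | a′ , b′ , c′ , r₂
  with IsCyclicOrderOn-resp-↭ (CycEq⇒↭ r₁) o₁ | IsCyclicOrderOn-resp-↭ (CycEq⇒↭ r₂) o₂
... | n₁@record { unique = _ ∷ u₁ } | n₂@record { unique = _ ∷ u₂ }
  with sign≡⇒CycEq u₁ u₂ (λ y∈ → ⊆tail n₁ (tail⊆ n₂ y∈))
         (trans (sym (signOn-normal o₂ r₂)) (trans (sym same) (signOn-normal o₁ r₁)))
... | xs , ys , eB , eA =
  Compatible-resp-CycEq (subst (λ A → CycEq _ (p ∷ A)) eA r₁) (subst (λ B → CycEq _ (q ∷ B)) eB r₂)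
    (compatible-normal {xs = xs} {ys} (subst (λ A → IsCyclicOrderOn D p (p ∷ A)) eA n₁)
                       (subst (λ B → IsCyclicOrderOn D q (q ∷ B)) eB n₂) p≢q)

signOn-reverse : IsCyclicOrderOn D p l → ∣ D ∣ ≡ 3 → signOn D (reverse l) ≡ not (signOn D l)
signOn-reverse {D = D} {p = p} {l = l} o ∣D∣≡3 with normalForm o ∣D∣≡3
... | a , b , c , r with IsCyclicOrderOn-resp-↭ (CycEq⇒↭ r) o
...   | record { unique = _ ∷ ((a≢b ∷ a≢c ∷ []) ∷ (b≢c ∷ []) ∷ [] ∷ []) } = begin
  signOn D (reverse l)      ≡⟨ signOn-normal (IsCyclicOrderOn-orient true o) reversed ⟩
  sign (c ∷ b ∷ a ∷ [])     ≡⟨ sign-reverse a≢b b≢c (≢-sym a≢c) ⟩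
  not (sign (a ∷ b ∷ c ∷ [])) ≡⟨ cong not (signOn-normal o r) ⟨
  not (signOn D l)          ∎
  where
  open ≡-Reasoning
  reversed : CycEq (reverse l) (p ∷ c ∷ b ∷ a ∷ [])
  reversed = CycEq-trans (CycEq-reverse r) (c ∷ b ∷ a ∷ [] , p ∷ [] , refl , refl)

signOn-orient : ∀ β → IsCyclicOrderOn D p l → ∣ D ∣ ≡ 3 → signOn D (orient β l) ≡ β xor signOn D l
signOn-orient false _ _ = refl
signOn-orient true  o ∣D∣≡3 = signOn-reverse o ∣D∣≡3

compatible-orient⇔ : ∀ {l₁ l₂} → IsCyclicOrderOn D p l₁ → IsCyclicOrderOn D q l₂ → ∣ D ∣ ≡ 3 → p ≢ q →
                     ∀ β β′ → Compatible (orient β l₁) (orient β′ l₂) ⇔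
                              (β xor β′ ≡ signOn D l₁ xor signOn D l₂)
compatible-orient⇔ {D = D} {l₁ = l₁} {l₂} o₁ o₂ ∣D∣≡3 p≢q β β′ = mk⇔
  (λ c → xor-interchange β σ₁ β′ σ₂
           (trans (sym (signOn-orient β o₁ ∣D∣≡3))
                  (trans (compatible⇒signOn≡ oriented₁ oriented₂ ∣D∣≡3 c) (signOn-orient β′ o₂ ∣D∣≡3))))
  (λ e → signOn≡⇒compatible oriented₁ oriented₂ ∣D∣≡3 p≢q
           (trans (signOn-orient β o₁ ∣D∣≡3)
                  (trans (xor-interchange β β′ σ₁ σ₂ e) (sym (signOn-orient β′ o₂ ∣D∣≡3)))))
  where
  σ₁ = signOn D l₁
  σ₂ = signOn D l₂
  oriented₁ = IsCyclicOrderOn-orient β o₁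
  oriented₂ = IsCyclicOrderOn-orient β′ o₂

-- Coboundaries on the Johnson graph

-- Edge k T a b: the (k+1)-sets T ∪ {a} and T ∪ {b} are adjacent in the Johnson graph.
-- Triangle k U c d z: the (k+2)-sets U ∪ {c,d}, U ∪ {c,z} and U ∪ {d,z} are pairwise adjacent.
Edge : ℕ → Subset n → Fin n → Fin n → Set
Edge k T a b = ∣ T ∣ ≡ k × a ∉ₛ T × b ∉ₛ T × a ≢ b

Triangle : ℕ → Subset n → Fin n → Fin n → Fin n → Set
Triangle k U c d z = ∣ U ∣ ≡ k × c ∉ₛ U × d ∉ₛ U × z ∉ₛ U × c ≢ d × c ≢ z × d ≢ z

Triangle⇒Edge : ∀ {k U} {c d z : Fin n} → Triangle k U c d z → Edge (suc k) (U ∪ ⁅ c ⁆) d z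
Triangle⇒Edge (∣U∣ , c∉U , d∉U , z∉U , c≢d , c≢z , d≢z) =
  trans (∣insert∣ c∉U) (cong suc ∣U∣) , ∉-insert d∉U (≢-sym c≢d) , ∉-insert z∉U (≢-sym c≢z) , d≢z

Edge-sym : ∀ {k T} {a b : Fin n} → Edge k T a b → Edge k T b a
Edge-sym (∣T∣ , a∉ , b∉ , a≢b) = ∣T∣ , b∉ , a∉ , ≢-sym a≢b

edge? : ∀ k T (a b : Fin n) → Dec (Edge k T a b)
edge? k T a b = (∣ T ∣ ℕ.≟ k) ×-dec ¬? (a ∈ₛ? T) ×-dec ¬? (b ∈ₛ? T) ×-dec ¬? (a ≟ b)

triangle? : ∀ k U (c d z : Fin n) → Dec (Triangle k U c d z)
triangle? k U c d z =
  (∣ U ∣ ℕ.≟ k) ×-dec ¬? (c ∈ₛ? U) ×-dec ¬? (d ∈ₛ? U) ×-dec ¬? (z ∈ₛ? U) ×-dec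
  ¬? (c ≟ d) ×-dec ¬? (c ≟ z) ×-dec ¬? (d ≟ z)

∣Edge∣ : ∀ {k T} {a b : Fin n} → Edge k T a b → ∣ (T ∪ ⁅ a ⁆) ∪ ⁅ b ⁆ ∣ ≡ 2 + k
∣Edge∣ (∣T∣ , a∉T , b∉T , a≢b) = ∣insert²∣ ∣T∣ a∉T b∉T a≢b

∣Triangle∣ : ∀ {k U} {c d z : Fin n} → Triangle k U c d z → ∣ ((U ∪ ⁅ c ⁆) ∪ ⁅ d ⁆) ∪ ⁅ z ⁆ ∣ ≡ 3 + k
∣Triangle∣ (∣U∣ , c∉U , d∉U , z∉U , c≢d , c≢z , d≢z) =
  trans (∣insert∣ (∉-insert (∉-insert z∉U (≢-sym c≢z)) (≢-sym d≢z)))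
        (cong suc (∣insert²∣ ∣U∣ c∉U d∉U c≢d))

module Coboundary {n : ℕ} (g : Subset n → Fin n → Bool) where

  δ : Subset n → Fin n → Fin n → Bool
  δ T a b = g T a xor g T b

  -- δ T a b labels the edge between T ∪ {a} and T ∪ {b}; around the triangle
  -- U ∪ {c,d}, U ∪ {c,z}, U ∪ {d,z} the labels sum to zero.
  CocycleAt : Subset n → Fin n → Fin n → Fin n → Set
  CocycleAt U c d z = δ (U ∪ ⁅ c ⁆) d z xor δ (U ∪ ⁅ d ⁆) c z ≡ δ (U ∪ ⁅ z ⁆) c d

  excess : (Subset n → Bool) → Subset n → Fin n → Bool
  excess φ T a = φ (T ∪ ⁅ a ⁆) xor g T a

  _⊆ˡ_ : Subset n → List (Fin n) → Set
  T ⊆ˡ zs = ∀ {y} → y ∈ₛ T → y ∈ zs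

  insert-⊆ˡ : ∀ {T a zs} → T ⊆ˡ zs → a ∈ zs → (T ∪ ⁅ a ⁆) ⊆ˡ zs
  insert-⊆ˡ T⊆ a∈ y∈ with ∈-insert⁻ y∈
  ... | inj₁ y∈T  = T⊆ y∈T
  ... | inj₂ refl = a∈

  ∈-tail : ∀ {y z} {zs : List (Fin n)} → y ∈ z ∷ zs → y ≢ z → y ∈ zs
  ∈-tail (here y≡z) y≢z = ⊥-elim (y≢z y≡z)
  ∈-tail (there y∈) _   = y∈

  ⊆ˡ-tail : ∀ {T z zs} → T ⊆ˡ (z ∷ zs) → z ∉ₛ T → T ⊆ˡ zs
  ⊆ˡ-tail T⊆ z∉T y∈T = ∈-tail (T⊆ y∈T) (λ { refl → z∉T y∈T })

  module _ (m : ℕ) (cocycle : ∀ {U c d z} → Triangle m U c d z → CocycleAt U c d z) where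

    Consistent : List (Fin n) → (Subset n → Bool) → Set
    Consistent zs φ = ∀ {T a b} → Edge (suc m) T a b → T ⊆ˡ zs → a ∈ zs → b ∈ zs →
                      excess φ T a ≡ excess φ T b

    -- Extending from zs to z ∷ zs, a set Y ∪ {z} takes the value transported along the edge from
    -- Y ∪ {c}, for the first c ∈ zs outside Y; by consistency the choice of c does not matter.
    transfer : (Subset n → Bool) → (Y : Subset n) → Fin n → ∀ {zs} → Dec (Any (_∉ₛ Y) zs) → Bool
    transfer φ Y z (yes c∉Y) with find c∉Y
    ... | c , _ , _ = excess φ Y c xor g Y z
    transfer φ Y z (no _) = false

    extend : (Subset n → Bool) → Fin n → List (Fin n) → Subset n → Bool
    extend φ z zs Q with z ∈ₛ? Q
    ... | yes _ = transfer φ (Q - z) z (Any.any? (λ c → ¬? (c ∈ₛ? (Q - z))) zs)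
    ... | no _  = φ Q

    extend-∉ : ∀ {φ z zs Q} → z ∉ₛ Q → extend φ z zs Q ≡ φ Q
    extend-∉ {z = z} {Q = Q} z∉Q with z ∈ₛ? Q
    ... | yes z∈Q = ⊥-elim (z∉Q z∈Q)
    ... | no _    = refl

    excess-extend : ∀ {φ z zs Y c} → Consistent zs φ → ∣ Y ∣ ≡ suc m → Y ⊆ˡ zs → z ∉ zs → c ∈ zs → c ∉ₛ Y →
                    excess (extend φ z zs) Y z ≡ excess φ Y c
    excess-extend {φ} {z} {zs} {Y} {c} consistent ∣Y∣ Y⊆zs z∉zs c∈zs c∉Y with z ∈ₛ? Y ∪ ⁅ z ⁆
    ... | no z∉ = ⊥-elim (z∉ ∈-insert-self)
    ... | yes _ rewrite remove-insert {X = Y} (λ z∈Y → z∉zs (Y⊆zs z∈Y)) =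
      transferred (Any.any? (λ c → ¬? (c ∈ₛ? Y)) zs)
      where
      transferred : (d : Dec (Any (_∉ₛ Y) zs)) → transfer φ Y z d xor g Y z ≡ excess φ Y c
      transferred (no ∄) = ⊥-elim (∄ (lose c∈zs c∉Y))
      transferred (yes ∃c′) with find ∃c′
      ... | c′ , c′∈zs , c′∉Y with c′ ≟ c
      ...   | yes refl = xor-cancelʳ (excess φ Y c) (g Y z)
      ...   | no c′≢c  =
        trans (xor-cancelʳ (excess φ Y c′) (g Y z)) (consistent (∣Y∣ , c′∉Y , c∉Y , c′≢c) Y⊆zs c′∈zs c∈zs)

    excess-entering : ∀ {φ z zs T b} → Consistent zs φ → z ∉ zs → Edge (suc m) T z b → T ⊆ˡ zs → b ∈ zs →
                      excess (extend φ z zs) T z ≡ excess (extend φ z zs) T b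
    excess-entering consistent z∉zs (∣T∣ , z∉T , b∉T , z≢b) T⊆zs b∈zs =
      trans (excess-extend consistent ∣T∣ T⊆zs z∉zs b∈zs b∉T)
            (cong (_xor g _ _) (sym (extend-∉ (∉-insert z∉T z≢b))))

    excess-above : ∀ {φ z zs U a b} → Consistent zs φ → z ∉ zs → ∣ U ∣ ≡ m → U ⊆ˡ zs →
                   a ∉ₛ U → b ∉ₛ U → a ≢ b → a ∈ zs → b ∈ zs →
                   excess (extend φ z zs) (U ∪ ⁅ z ⁆) a ≡
                   φ ((U ∪ ⁅ a ⁆) ∪ ⁅ b ⁆) xor (δ (U ∪ ⁅ a ⁆) b z xor g (U ∪ ⁅ z ⁆) a)
    excess-above {φ} {z} {zs} {U} {a} {b} consistent z∉zs ∣U∣ U⊆zs a∉U b∉U a≢b a∈zs b∈zs = begin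
      φ′ ((U ∪ ⁅ z ⁆) ∪ ⁅ a ⁆) xor g Uz a          ≡⟨ cong (λ Q → φ′ Q xor g Uz a) (insert-comm U z a) ⟩
      φ′ (Ua ∪ ⁅ z ⁆) xor g Uz a                   ≡⟨ cong (_xor g Uz a) (xor-cancelʳ (φ′ (Ua ∪ ⁅ z ⁆)) (g Ua z)) ⟨
      (excess φ′ Ua z xor g Ua z) xor g Uz a       ≡⟨ cong (λ x → (x xor g Ua z) xor g Uz a) above ⟩
      ((φ S xor g Ua b) xor g Ua z) xor g Uz a     ≡⟨ cong (_xor g Uz a) (xor-assoc (φ S) (g Ua b) (g Ua z)) ⟩
      (φ S xor δ Ua b z) xor g Uz a                ≡⟨ xor-assoc (φ S) (δ Ua b z) (g Uz a) ⟩
      φ S xor (δ Ua b z xor g Uz a)                ∎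
      where
      open ≡-Reasoning
      φ′ = extend φ z zs
      Ua = U ∪ ⁅ a ⁆
      Uz = U ∪ ⁅ z ⁆
      S  = Ua ∪ ⁅ b ⁆
      above : excess φ′ Ua z ≡ excess φ Ua b
      above = excess-extend consistent (trans (∣insert∣ a∉U) (cong suc ∣U∣)) (insert-⊆ˡ U⊆zs a∈zs) z∉zs b∈zs
                (∉-insert b∉U (≢-sym a≢b))

    excess-through : ∀ {φ z zs T a b} → Consistent zs φ → z ∉ zs → Edge (suc m) T a b → z ∈ₛ T →
                     T ⊆ˡ (z ∷ zs) → a ∈ z ∷ zs → b ∈ z ∷ zs →
                     excess (extend φ z zs) T a ≡ excess (extend φ z zs) T b
    excess-through {φ} {z} {zs} {T} {a} {b} consistent z∉zs (∣T∣ , a∉T , b∉T , a≢b) z∈T T⊆ a∈ b∈ =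
      subst (λ T → excess φ′ T a ≡ excess φ′ T b) (insert-remove z∈T) (begin
        excess φ′ (T∖z ∪ ⁅ z ⁆) a
          ≡⟨ excess-above consistent z∉zs ∣T∖z∣ T∖z⊆zs a∉T∖z b∉T∖z a≢b a∈zs b∈zs ⟩
        φ ((T∖z ∪ ⁅ a ⁆) ∪ ⁅ b ⁆) xor (δ (T∖z ∪ ⁅ a ⁆) b z xor g (T∖z ∪ ⁅ z ⁆) a)
          ≡⟨ cong₂ (λ S x → φ S xor x) (insert-comm T∖z a b) balanced ⟩
        φ ((T∖z ∪ ⁅ b ⁆) ∪ ⁅ a ⁆) xor (δ (T∖z ∪ ⁅ b ⁆) a z xor g (T∖z ∪ ⁅ z ⁆) b)
          ≡⟨ excess-above consistent z∉zs ∣T∖z∣ T∖z⊆zs b∉T∖z a∉T∖z (≢-sym a≢b) b∈zs a∈zs ⟨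
        excess φ′ (T∖z ∪ ⁅ z ⁆) b
          ∎)
      where
      open ≡-Reasoning
      φ′ = extend φ z zs
      T∖z = T - z
      ∣T∖z∣ : ∣ T∖z ∣ ≡ m
      ∣T∖z∣ = suc-injective (trans (sym (∣remove∣ z∈T)) ∣T∣)
      T∖z⊆zs : T∖z ⊆ˡ zs
      T∖z⊆zs y∈T∖z with ∈-remove⁻ y∈T∖z
      ... | y∈T , y≢z = ∈-tail (T⊆ y∈T) y≢z
      a∉T∖z : a ∉ₛ T∖z
      a∉T∖z a∈T∖z = a∉T (proj₁ (∈-remove⁻ a∈T∖z))
      b∉T∖z : b ∉ₛ T∖z
      b∉T∖z b∈T∖z = b∉T (proj₁ (∈-remove⁻ b∈T∖z))
      a≢z : a ≢ z
      a≢z refl = a∉T z∈T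
      b≢z : b ≢ z
      b≢z refl = b∉T z∈T
      a∈zs = ∈-tail a∈ a≢z
      b∈zs = ∈-tail b∈ b≢z
      balanced : δ (T∖z ∪ ⁅ a ⁆) b z xor g (T∖z ∪ ⁅ z ⁆) a ≡ δ (T∖z ∪ ⁅ b ⁆) a z xor g (T∖z ∪ ⁅ z ⁆) b
      balanced = xor-interchange (δ (T∖z ∪ ⁅ a ⁆) b z) (δ (T∖z ∪ ⁅ b ⁆) a z) (g (T∖z ∪ ⁅ z ⁆) a) (g (T∖z ∪ ⁅ z ⁆) b)
        (cocycle (∣T∖z∣ , a∉T∖z , b∉T∖z , ∉-remove-self , a≢b , a≢z , b≢z))

    consistent-extend : ∀ {φ z zs} → z ∉ zs → Consistent zs φ → Consistent (z ∷ zs) (extend φ z zs)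
    consistent-extend {φ} {z} {zs} z∉zs consistent {T} {a} {b} e@(∣T∣ , a∉T , b∉T , a≢b) T⊆ a∈ b∈ with z ∈ₛ? T
    ... | yes z∈T = excess-through consistent z∉zs e z∈T T⊆ a∈ b∈
    ... | no z∉T with a ≟ z | b ≟ z
    ...   | yes refl | yes refl = ⊥-elim (a≢b refl)
    ...   | yes refl | no b≢z   = excess-entering consistent z∉zs e (⊆ˡ-tail T⊆ z∉T) (∈-tail b∈ b≢z)
    ...   | no a≢z   | yes refl =
      sym (excess-entering consistent z∉zs (Edge-sym e) (⊆ˡ-tail T⊆ z∉T) (∈-tail a∈ a≢z))
    ...   | no a≢z   | no b≢z   =
      trans (cong (_xor g T a) (extend-∉ (∉-insert z∉T (≢-sym a≢z))))
            (trans (consistent e (⊆ˡ-tail T⊆ z∉T) (∈-tail a∈ a≢z) (∈-tail b∈ b≢z))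
                   (cong (_xor g T b) (sym (extend-∉ (∉-insert z∉T (≢-sym b≢z))))))

    potential : List (Fin n) → Subset n → Bool
    potential []       _ = false
    potential (z ∷ zs)   = extend (potential zs) z zs

    potential-consistent : ∀ {zs} → Unique zs → Consistent zs (potential zs)
    potential-consistent {[]}     _          _ _ ()
    potential-consistent {z ∷ zs} (z∉ ∷ uzs) = consistent-extend (All¬⇒¬Any z∉) (potential-consistent uzs)

    coboundary : Σ (Subset n → Bool) λ Φ →
                 ∀ {T a b} → Edge (suc m) T a b → Φ (T ∪ ⁅ a ⁆) xor Φ (T ∪ ⁅ b ⁆) ≡ δ T a b
    coboundary = Φ , λ {T} {a} {b} e → xor-interchange (Φ (T ∪ ⁅ a ⁆)) (g T a) (Φ (T ∪ ⁅ b ⁆)) (g T b)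
      (potential-consistent (allFin⁺ n) e (λ {y} _ → ∈-allFin y) (∈-allFin a) (∈-allFin b))
      where Φ = potential (allFin n)

-- Rotation systems on 5-sets

module Rotations {n : ℕ} (R : Assignment n) (isRotation : ∀ Q → ∣ Q ∣ ≡ 5 → IsRotationSystem Q (R Q))
  where

  rotation-cyclicOrder : ∣ T ∣ ≡ 4 → a ∉ₛ T → x ∈ₛ T → IsCyclicOrderOn (T - x) a (R (T ∪ ⁅ a ⁆) x)
  rotation-cyclicOrder {T = T} {a = a} {x = x} ∣T∣ a∉T x∈T
    with isRotation (T ∪ ⁅ a ⁆) (trans (∣insert∣ a∉T) (cong suc ∣T∣)) x (∈-insert⁺ x∈T)
  ... | unique , members = record
    { unique   = unique
    ; sound    = ∈R⇒
    ; complete = ⇒∈R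
    ; fresh    = λ a∈ → a∉T (proj₁ (∈-remove⁻ a∈))
    }
    where
    ∈R⇒ : ∀ {y} → y ∈ R (T ∪ ⁅ a ⁆) x → y ∈ₛ T - x ⊎ y ≡ a
    ∈R⇒ y∈ with Equivalence.to (members _) y∈
    ... | y∈Q , y≢x with ∈-insert⁻ y∈Q
    ...   | inj₁ y∈T = inj₁ (x∈p∧x≢y⇒x∈p-y y∈T y≢x)
    ...   | inj₂ y≡a = inj₂ y≡a
    ⇒∈R : ∀ {y} → y ∈ₛ T - x ⊎ y ≡ a → y ∈ R (T ∪ ⁅ a ⁆) x
    ⇒∈R (inj₁ y∈) with ∈-remove⁻ y∈
    ... | y∈T , y≢x = Equivalence.from (members _) (∈-insert⁺ y∈T , y≢x)
    ⇒∈R (inj₂ refl) = Equivalence.from (members _) (∈-insert-self , λ { refl → a∉T x∈T })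

  rotationSign : Fin n → Subset n → Fin n → Bool
  rotationSign x T a = signOn (T - x) (R (T ∪ ⁅ a ⁆) x)

  compatible⇔ : Edge 4 T a b → x ∈ₛ T → ∀ β β′ →
                Compatible (orient β (R (T ∪ ⁅ a ⁆) x)) (orient β′ (R (T ∪ ⁅ b ⁆) x)) ⇔
                (β xor β′ ≡ rotationSign x T a xor rotationSign x T b)
  compatible⇔ (∣T∣ , a∉T , b∉T , a≢b) x∈T =
    compatible-orient⇔ (rotation-cyclicOrder ∣T∣ a∉T x∈T) (rotation-cyclicOrder ∣T∣ b∉T x∈T)
      (suc-injective (trans (sym (∣remove∣ x∈T)) ∣T∣)) a≢b

  IsOrientation : (Subset n → Set) → (Subset n → Bool) → Set
  IsOrientation W Φ = ∀ Q Q′ → W Q → W Q′ → ∣ Q ∩ Q′ ∣ ≡ 4 → ∀ x → x ∈ₛ Q → x ∈ₛ Q′ →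
                      Compatible (orient (Φ Q) (R Q x)) (orient (Φ Q′) (R Q′ x))

  orientation-edge : ∀ {W Φ} → IsOrientation W Φ → W (T ∪ ⁅ a ⁆) → W (T ∪ ⁅ b ⁆) → Edge 4 T a b →
                     x ∈ₛ T → Φ (T ∪ ⁅ a ⁆) xor Φ (T ∪ ⁅ b ⁆) ≡ rotationSign x T a xor rotationSign x T b
  orientation-edge {T = T} {a = a} {b = b} {x = x} {Φ = Φ} orientation Wa Wb e@(∣T∣ , _ , _ , a≢b) x∈T =
    Equivalence.to (compatible⇔ e x∈T (Φ (T ∪ ⁅ a ⁆)) (Φ (T ∪ ⁅ b ⁆)))
      (orientation _ _ Wa Wb (trans (cong ∣_∣ (insert-∩ T a≢b)) ∣T∣) x (∈-insert⁺ x∈T) (∈-insert⁺ x∈T))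

  orientation-of-edges : ∀ {Φ} →
    (∀ {T a b x} → Edge 4 T a b → x ∈ₛ T →
                   Φ (T ∪ ⁅ a ⁆) xor Φ (T ∪ ⁅ b ⁆) ≡ rotationSign x T a xor rotationSign x T b) →
    IsOrientation (λ Q → ∣ Q ∣ ≡ 5) Φ
  orientation-of-edges {Φ} law Q Q′ ∣Q∣ ∣Q′∣ ∣Q∩Q′∣ x x∈Q x∈Q′
    with insert-decomposition (p∩q⊆p Q Q′) (trans ∣Q∣ (cong suc (sym ∣Q∩Q′∣)))
       | insert-decomposition (p∩q⊆q Q Q′) (trans ∣Q′∣ (cong suc (sym ∣Q∩Q′∣)))
  ... | a , a∉T , Q≡ | b , b∉T , Q′≡ =
    subst₂ (λ Q Q′ → Compatible (orient (Φ Q) (R Q x)) (orient (Φ Q′) (R Q′ x))) (sym Q≡) (sym Q′≡)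
      (Equivalence.from (compatible⇔ e x∈T (Φ (Q ∩ Q′ ∪ ⁅ a ⁆)) (Φ (Q ∩ Q′ ∪ ⁅ b ⁆))) (law e x∈T))
    where
    x∈T = x∈p∩q⁺ (x∈Q , x∈Q′)
    a≢b : a ≢ b
    a≢b refl = 4≢5 (begin
      4          ≡⟨ ∣Q∩Q′∣ ⟨
      ∣ Q ∩ Q′ ∣ ≡⟨ cong (λ Q′ → ∣ Q ∩ Q′ ∣) (trans Q′≡ (sym Q≡)) ⟩
      ∣ Q ∩ Q ∣  ≡⟨ cong ∣_∣ (∩-idem Q) ⟩
      ∣ Q ∣      ≡⟨ ∣Q∣ ⟩
      5          ∎)
      where
      open ≡-Reasoning
      4≢5 : 4 ≢ 5
      4≢5 ()
    e = ∣Q∩Q′∣ , a∉T , b∉T , a≢b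

  -- Read at an arbitrary point of T; absent edge defects the point does not matter, and the
  -- value for empty T is never used.
  referenceSign : Subset n → Fin n → Bool
  referenceSign T a with nonempty? T
  ... | yes (x , _) = rotationSign x T a
  ... | no _        = false

  referenceSign-spec : ∀ {k} → ∣ T ∣ ≡ suc k →
                       ∃ λ x₀ → x₀ ∈ₛ T × ∀ a → referenceSign T a ≡ rotationSign x₀ T a
  referenceSign-spec {T = T} ∣T∣ with nonempty? T
  ... | yes (x₀ , x₀∈T) = x₀ , x₀∈T , λ _ → refl
  ... | no ¬ne          = ⊥-elim (¬ne (∣∣≡suc⇒Nonempty ∣T∣))

  open Coboundary referenceSign

  Within : Subset n → Subset n → Set
  Within S Q = Q ⊆ S × ∣ Q ∣ ≡ 5

  orientation-δ : ∀ {W Φ} → IsOrientation W Φ → W (T ∪ ⁅ a ⁆) → W (T ∪ ⁅ b ⁆) → Edge 4 T a b →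
                  Φ (T ∪ ⁅ a ⁆) xor Φ (T ∪ ⁅ b ⁆) ≡ δ T a b
  orientation-δ {W = W} {Φ} orientation Wa Wb e@(∣T∣ , _) with referenceSign-spec ∣T∣
  ... | x₀ , x₀∈T , ref =
    trans (orientation-edge {W = W} {Φ} orientation Wa Wb e x₀∈T) (sym (cong₂ _xor_ (ref _) (ref _)))

  EdgeDefect : Subset n → Fin n → Fin n → Fin n → Set
  EdgeDefect T a b x = Edge 4 T a b × x ∈ₛ T × rotationSign x T a xor rotationSign x T b ≢ δ T a b

  TriangleDefect : Subset n → Fin n → Fin n → Fin n → Set
  TriangleDefect U c d z = Triangle 3 U c d z × ¬ CocycleAt U c d z

  edgeDefect-nonOrientable : EdgeDefect T a b x → ¬ Orientable (Within ((T ∪ ⁅ a ⁆) ∪ ⁅ b ⁆)) R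
  edgeDefect-nonOrientable {T = T} {a = a} {b = b} (e@(∣T∣ , a∉T , b∉T , _) , x∈T , defect) (Φ , orientation) =
    defect (trans (sym (orientation-edge {Φ = Φ} orientation Wa Wb e x∈T))
                  (orientation-δ {Φ = Φ} orientation Wa Wb e))
    where
    Wa : Within ((T ∪ ⁅ a ⁆) ∪ ⁅ b ⁆) (T ∪ ⁅ a ⁆)
    Wa = p⊆p∪q ⁅ b ⁆ , trans (∣insert∣ a∉T) (cong suc ∣T∣)
    Wb : Within ((T ∪ ⁅ a ⁆) ∪ ⁅ b ⁆) (T ∪ ⁅ b ⁆)
    Wb = insert-⊆ (λ y∈T → ∈-insert⁺ (∈-insert⁺ y∈T)) ∈-insert-self , trans (∣insert∣ b∉T) (cong suc ∣T∣)

  triangleDefect-nonOrientable : TriangleDefect U c d z →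
                                 ¬ Orientable (Within (((U ∪ ⁅ c ⁆) ∪ ⁅ d ⁆) ∪ ⁅ z ⁆)) R
  triangleDefect-nonOrientable {U = U} {c} {d} {z} (t@(∣U∣ , c∉U , d∉U , z∉U , c≢d , c≢z , d≢z) , notCocycle)
                               (Φ , orientation) =
    notCocycle (begin
      δ (U ∪ ⁅ c ⁆) d z xor δ (U ∪ ⁅ d ⁆) c z  ≡⟨ cong₂ _xor_ (sym edge₁) (sym edge₂) ⟩
      (Φ Scd xor Φ Scz) xor (Φ Scd xor Φ Sdz)  ≡⟨ xor-triangle (Φ Scd) (Φ Scz) (Φ Sdz) ⟩
      Φ Scz xor Φ Sdz                          ≡⟨ edge₃ ⟩
      δ (U ∪ ⁅ z ⁆) c d                        ∎)
    where
    open ≡-Reasoning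
    Scd = (U ∪ ⁅ c ⁆) ∪ ⁅ d ⁆
    Scz = (U ∪ ⁅ c ⁆) ∪ ⁅ z ⁆
    Sdz = (U ∪ ⁅ d ⁆) ∪ ⁅ z ⁆
    S = Scd ∪ ⁅ z ⁆
    U⊆S : U ⊆ S
    U⊆S y∈U = ∈-insert⁺ (∈-insert⁺ (∈-insert⁺ y∈U))
    edge : ∀ {x y w} → Triangle 3 U x y w → x ∈ₛ S → y ∈ₛ S → w ∈ₛ S →
           Φ ((U ∪ ⁅ x ⁆) ∪ ⁅ y ⁆) xor Φ ((U ∪ ⁅ x ⁆) ∪ ⁅ w ⁆) ≡ δ (U ∪ ⁅ x ⁆) y w
    edge t′@(_ , x∉U , y∉U , w∉U , x≢y , x≢w , _) x∈S y∈S w∈S = orientation-δ {Φ = Φ} orientation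
      (insert-⊆ (insert-⊆ U⊆S x∈S) y∈S , ∣insert²∣ ∣U∣ x∉U y∉U x≢y)
      (insert-⊆ (insert-⊆ U⊆S x∈S) w∈S , ∣insert²∣ ∣U∣ x∉U w∉U x≢w)
      (Triangle⇒Edge t′)
    z∈S = ∈-insert-self
    d∈S = ∈-insert⁺ ∈-insert-self
    c∈S = ∈-insert⁺ (∈-insert⁺ ∈-insert-self)
    edge₁ : Φ Scd xor Φ Scz ≡ δ (U ∪ ⁅ c ⁆) d z
    edge₁ = edge t c∈S d∈S z∈S
    edge₂ : Φ Scd xor Φ Sdz ≡ δ (U ∪ ⁅ d ⁆) c z
    edge₂ = subst (λ Q → Φ Q xor Φ Sdz ≡ δ (U ∪ ⁅ d ⁆) c z) (insert-comm U d c)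
                  (edge (∣U∣ , d∉U , c∉U , z∉U , ≢-sym c≢d , d≢z , c≢z) d∈S c∈S z∈S)
    edge₃ : Φ Scz xor Φ Sdz ≡ δ (U ∪ ⁅ z ⁆) c d
    edge₃ = subst₂ (λ Q Q′ → Φ Q xor Φ Q′ ≡ δ (U ∪ ⁅ z ⁆) c d) (insert-comm U z c) (insert-comm U z d)
                   (edge (∣U∣ , z∉U , c∉U , d∉U , ≢-sym c≢z , ≢-sym d≢z , c≢d) z∈S c∈S d∈S)

  edgeDefect? : ∀ T a b x → Dec (EdgeDefect T a b x)
  edgeDefect? T a b x = edge? 4 T a b ×-dec (x ∈ₛ? T) ×-dec ¬? (_ Bool.≟ _)

  triangleDefect? : ∀ U c d z → Dec (TriangleDefect U c d z)
  triangleDefect? U c d z = triangle? 3 U c d z ×-dec ¬? (_ Bool.≟ _)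

  defectFree-orientable : (∀ {T a b x} → ¬ EdgeDefect T a b x) → (∀ {U c d z} → ¬ TriangleDefect U c d z) →
                          Orientable (λ Q → ∣ Q ∣ ≡ 5) R
  defectFree-orientable noEdgeDefect noTriangleDefect
    with coboundary 3 (λ t → decidable-stable (_ Bool.≟ _) (λ ¬cocycle → noTriangleDefect (t , ¬cocycle)))
  ... | Φ , Φ-δ = Φ , orientation-of-edges {Φ = Φ} λ e x∈T →
    trans (Φ-δ e) (sym (decidable-stable (_ Bool.≟ _) (λ defect → noEdgeDefect (e , x∈T , defect))))

lemma1 : (n : ℕ) → 5 ≤ n → (R : Assignment n) →
         (∀ Q → ∣ Q ∣ ≡ 5 → IsRotationSystem Q (R Q)) →
         ¬ Orientable (λ Q → ∣ Q ∣ ≡ 5) R →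
         Σ (Subset n) λ S → ∣ S ∣ ≡ 6 ×
           ¬ Orientable (λ Q → Q ⊆ S × ∣ Q ∣ ≡ 5) R
lemma1 n _ R isRotation notOrientable = sixSet
  where
  open Rotations R isRotation
  sixSet : Σ (Subset n) λ S → ∣ S ∣ ≡ 6 × ¬ Orientable (λ Q → Q ⊆ S × ∣ Q ∣ ≡ 5) R
  sixSet with anySubset? (λ T → any? λ a → any? λ b → any? λ x → edgeDefect? T a b x)
  ... | yes (T , a , b , x , defect) =
    (T ∪ ⁅ a ⁆) ∪ ⁅ b ⁆ , ∣Edge∣ (proj₁ defect) , edgeDefect-nonOrientable defect
  ... | no noEdgeDefect with anySubset? (λ U → any? λ c → any? λ d → any? λ z → triangleDefect? U c d z)
  ...   | yes (U , c , d , z , defect) =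
    ((U ∪ ⁅ c ⁆) ∪ ⁅ d ⁆) ∪ ⁅ z ⁆ , ∣Triangle∣ (proj₁ defect) , triangleDefect-nonOrientable defect
  ...   | no noTriangleDefect = ⊥-elim (notOrientable (defectFree-orientable
            (λ defect → noEdgeDefect (_ , _ , _ , _ , defect))
            (λ defect → noTriangleDefect (_ , _ , _ , _ , defect))))
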